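{- Let $Q$ be a quadruple system of order $v$. If there is a Kirkman triple system $K(Q)$ built from $Q$ which is $\delta$-colourable, then $Q$ has a $\delta$-colouring.
   Context: A quadruple system of order $v$ is a set of $v$ points with a set of $4$-subsets (blocks) such that each pair of points lies in exactly one block. Given a quadruple system $Q$ on points $\{q_0,\dots,q_{v-1}\}$, a $K(Q)$ is a Kirkman triple system (Steiner triple system with a partition of its triples into parallel classes) on the point set $\{\infty\}\cup\{q_i,q_i' : 0\le i\le v-1\}$ obtained as follows: for each block $\{w,x,y,z\}$ of $Q$, place the triples of a KTS$(9)$ on $\{\infty,w,x,y,z,w',x',y',z'\}$ in such a way that the triples containing $\infty$ are $\{\infty,w,w'\},\{\infty,x,x'\},\{\infty,y,y'\},\{\infty,z,z'\}$; the placement is not unique, so several $K(Q)$ may arise. A $\delta$-colouring of a design is a map from its points to a set of $\delta$ colours such that no block is monochromatic; the design is $\delta$-colourable if it has one. -}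

module Defs where

open import Data.Nat using (ℕ; suc; _+_)
open import Data.Bool using (Bool; true)
open import Data.Fin using (Fin; zero; suc; _↑ˡ_; _↑ʳ_)
open import Data.Fin.Subset using (Subset; _∈_; ∣_∣; ⁅_⁆; _∪_)
open import Data.Product using (Σ; ∃; ∃!; _×_; _,_)
open import Data.Sum using (_⊎_)
open import Relation.Binary.PropositionalEquality using (_≡_; _≢_)
open import Relation.Nullary using (¬_)

-- A "design" on the points Fin n is given by its set of blocks, represented
-- as a Boolean predicate on subsets of Fin n (a subset is a block iff the
-- predicate returns true).  Blocks are genuine sets, so "exactly one block"
-- is unique existence up to equality of subsets.
Blocks : ℕ → Set
Blocks n = Subset n → Bool

IsSteiner : {n : ℕ} → ℕ → (Fin n → Set) → Blocks n → Set
IsSteiner {n} k S T =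
  (∀ (B : Subset n) → T B ≡ true → (∀ x → x ∈ B → S x) × ∣ B ∣ ≡ k)
  × (∀ (x y : Fin n) → S x → S y → x ≢ y →
       ∃! _≡_ (λ B → T B ≡ true × x ∈ B × y ∈ B))

-- Kirkman triple system on point set S: a Steiner triple system together
-- with a resolution, i.e. a partition of the triples into r classes
-- (class of a triple given by cl) such that every class is a parallel
-- class: every point of S lies in exactly one triple of the class.
IsKTS : {n : ℕ} → (Fin n → Set) → Blocks n → Set
IsKTS {n} S T =
  IsSteiner 3 S T
  × Σ ℕ (λ r → Σ (Subset n → Fin r) (λ cl →
      ∀ (i : Fin r) (x : Fin n) → S x →
        ∃! _≡_ (λ B → T B ≡ true × cl B ≡ i × x ∈ B)))

AllPoints : {n : ℕ} → Fin n → Set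
AllPoints _ = Data.Unit.⊤
  where import Data.Unit

-- Quadruple system of order v on points Fin v (q_i is i).
IsQS : (v : ℕ) → Blocks v → Set
IsQS v Q = IsSteiner 4 AllPoints Q

-- Points of K(Q): Fin (1 + (v + v)), with
--   ∞     = zero
--   q_i   = suc (i ↑ˡ v)
--   q_i'  = suc (v ↑ʳ i)
KPt : ℕ → Set
KPt v = Fin (suc (v + v))

∞pt : (v : ℕ) → KPt v
∞pt _ = zero

qpt : (v : ℕ) → Fin v → KPt v
qpt v i = suc (i ↑ˡ v)

q'pt : (v : ℕ) → Fin v → KPt v
q'pt v i = suc (v ↑ʳ i)

triple : {n : ℕ} → Fin n → Fin n → Fin n → Subset n
triple a b c = ⁅ a ⁆ ∪ (⁅ b ⁆ ∪ ⁅ c ⁆)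

BlockPts : {v : ℕ} → Subset v → KPt v → Set
BlockPts {v} b x =
  (x ≡ ∞pt v) ⊎ (∃ λ i → i ∈ b × ((x ≡ qpt v i) ⊎ (x ≡ q'pt v i)))

-- A placement for block b: a KTS(9) on BlockPts b whose triples containing
-- ∞ are exactly the triples {∞, q_i, q_i'} with i ∈ b (that all of these
-- occur follows from the Steiner property).
IsPlacement : {v : ℕ} → Subset v → Blocks (suc (v + v)) → Set
IsPlacement {v} b P =
  IsKTS (BlockPts b) P
  × (∀ (B : Subset (suc (v + v))) → P B ≡ true → ∞pt v ∈ B →
       ∃ λ i → i ∈ b × B ≡ triple (∞pt v) (qpt v i) (q'pt v i))

IsKQ : {v : ℕ} → Blocks v → Blocks (suc (v + v)) → Set
IsKQ {v} Q T =
  IsKTS AllPoints T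
  × Σ (Subset v → Blocks (suc (v + v))) (λ P →
      (∀ b → Q b ≡ true → IsPlacement b (P b))
      × (∀ B → (T B ≡ true → ∃ λ b → Q b ≡ true × P b B ≡ true)
               × ((∃ λ b → Q b ≡ true × P b B ≡ true) → T B ≡ true)))

Monochromatic : {n δ : ℕ} → (Fin n → Fin δ) → Subset n → Set
Monochromatic c B = ∀ x y → x ∈ B → y ∈ B → c x ≡ c y

IsColouring : {n : ℕ} → (δ : ℕ) → Blocks n → (Fin n → Fin δ) → Set
IsColouring δ T c = ∀ B → T B ≡ true → ¬ Monochromatic c B

Colourable : {n : ℕ} → (δ : ℕ) → Blocks n → Set
Colourable {n} δ T = Σ (Fin n → Fin δ) (IsColouring δ T)

-- If K(Q) is properly δ-coloured by c, colour each point i of Q by c(q_i).  This is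
-- proper because every placed KTS(9) on {∞} ∪ {q_i, q_i' : i ∈ b} contains a triple
-- {q_i, q_j, q_k} of unprimed points, which c does not make monochromatic.  Otherwise
-- the triple through q_i and q_j (i ≠ j) is some {q_i, q_j, q_k'}: the ∞-triples exclude
-- ∞ and force k ∉ {i, j}.  This labels every pair of the 4-set b by a third element, and
-- the labels of the pairs at a fixed i are distinct, since q_i and q_k' lie on only one
-- triple.  Starting from the label of one pair these constraints propagate and force
-- two pairs at a common point to share a label.
module Submission where

open import Data.Bool using (true)
open import Data.Empty using (⊥; ⊥-elim)
open import Data.Fin using (Fin; zero; suc; splitAt)
open import Data.Fin.Properties using (_≟_; ↑ˡ-injective; splitAt-↑ˡ; splitAt-↑ʳ)
import Data.Fin.Properties as Fin
open import Data.Fin.Subset using (Subset; inside; outside; _∈_; _∉_; _-_; ∣_∣; Nonempty; ⁅_⁆; _∪_)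
open import Data.Fin.Subset.Properties
  using (x∈p∧x≢y⇒x∈p-y; p─q⊆p; p─⊥≡p; nonempty?; Empty-unique; ∣⊥∣≡0; x∈p⇒∣p-x∣<∣p∣;
         x∈p∪q⁻; x∈p∪q⁺; x∈⁅x⁆; x∈⁅y⁆⇒x≡y)
open import Data.List using (List; []; _∷_; length)
open import Data.List.Membership.Propositional using () renaming (_∈_ to _∈ˡ_)
open import Data.List.Relation.Unary.All using (All; []; _∷_)
open import Data.List.Relation.Unary.All.Properties using (¬Any⇒All¬)
open import Data.List.Relation.Unary.AllPairs using (AllPairs; []; _∷_)
open import Data.List.Relation.Unary.Any using (here; there; any?)
open import Data.Nat using (ℕ; zero; suc; _+_; _≤_; _<_)
open import Data.Nat.Properties
  using (+-suc; +-identityʳ; +-cancelˡ-≡; +-cancelˡ-<; <-irrefl; n≮0; <⇒≤; ≤-refl; ≤-reflexive)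
open import Data.Product using (∃; _×_; _,_; proj₁; proj₂; map₂)
open import Data.Sum using (_⊎_; inj₁; inj₂)
open import Data.Vec.Base using (Vec; toList; _∷_; []; here; there)
open import Data.Vec.Properties using (length-toList)
open import Function using (_∘_; _∘′_)
open import Relation.Nullary using (yes; no)
open import Relation.Binary.PropositionalEquality
  using (_≡_; _≢_; refl; sym; trans; cong; subst; subst₂; ≢-sym; module ≡-Reasoning)

open import Defs

private variable
  n : ℕ
  p : Subset n
  x y : Fin n
  xs : List (Fin n)

x∉p-x : ∀ (p : Subset n) x → x ∉ p - x
x∉p-x (inside ∷ p) zero ()
x∉p-x (outside ∷ p) zero ()
x∉p-x (_ ∷ p) (suc x) (there x∈p-x) = x∉p-x p x x∈p-x

x∈p-y⇒x≢y : x ∈ p - y → x ≢ y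
x∈p-y⇒x≢y {p = p} x∈p-y refl = x∉p-x p _ x∈p-y

x∈p⇒suc∣p-x∣≡∣p∣ : x ∈ p → suc ∣ p - x ∣ ≡ ∣ p ∣
x∈p⇒suc∣p-x∣≡∣p∣ {p = inside ∷ p} here = cong (suc ∘′ ∣_∣) (p─⊥≡p p)
x∈p⇒suc∣p-x∣≡∣p∣ {p = inside ∷ p} (there x∈p) = cong suc (x∈p⇒suc∣p-x∣≡∣p∣ x∈p)
x∈p⇒suc∣p-x∣≡∣p∣ {p = outside ∷ p} (there x∈p) = x∈p⇒suc∣p-x∣≡∣p∣ x∈p

0<∣p∣⇒nonempty : ∀ (p : Subset n) → 0 < ∣ p ∣ → Nonempty p
0<∣p∣⇒nonempty {n} p 0<∣p∣ with nonempty? p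
... | yes p≠∅ = p≠∅
... | no p=∅ = ⊥-elim (<-irrefl (trans (sym (∣⊥∣≡0 n)) (cong ∣_∣ (sym (Empty-unique p=∅)))) 0<∣p∣)

_∖_ : Subset n → List (Fin n) → Subset n
p ∖ [] = p
p ∖ (x ∷ xs) = (p ∖ xs) - x

∈-∖⁺ : y ∈ p → All (y ≢_) xs → y ∈ p ∖ xs
∈-∖⁺ y∈p [] = y∈p
∈-∖⁺ y∈p (y≢x ∷ y∉xs) = x∈p∧x≢y⇒x∈p-y (∈-∖⁺ y∈p y∉xs) y≢x

∈-∖⁻ : ∀ xs → y ∈ p ∖ xs → y ∈ p × All (y ≢_) xs
∈-∖⁻ [] y∈p = y∈p , []
∈-∖⁻ {p = p} (x ∷ xs) y∈p∖xs-x with ∈-∖⁻ xs (p─q⊆p (p ∖ xs) ⁅ x ⁆ y∈p∖xs-x)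
... | y∈p , y∉xs = y∈p , x∈p-y⇒x≢y y∈p∖xs-x ∷ y∉xs

DistinctMembers : Subset n → List (Fin n) → Set
DistinctMembers p xs = All (_∈ p) xs × AllPairs _≢_ xs

∣∖∣ : DistinctMembers p xs → length xs + ∣ p ∖ xs ∣ ≡ ∣ p ∣
∣∖∣ ([] , []) = refl
∣∖∣ {p = p} {xs = x ∷ xs} (x∈p ∷ xs⊆p , x∉xs ∷ xs-distinct) = begin
  suc (length xs + ∣ p ∖ xs - x ∣) ≡⟨ sym (+-suc (length xs) _) ⟩
  length xs + suc ∣ p ∖ xs - x ∣  ≡⟨ cong (length xs +_) (x∈p⇒suc∣p-x∣≡∣p∣ (∈-∖⁺ x∈p x∉xs)) ⟩
  length xs + ∣ p ∖ xs ∣          ≡⟨ ∣∖∣ (xs⊆p , xs-distinct) ⟩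
  ∣ p ∣                            ∎
  where open ≡-Reasoning

fresh-member : DistinctMembers p xs → length xs < ∣ p ∣ → ∃ λ y → y ∈ p × All (y ≢_) xs
fresh-member {p = p} {xs = xs} xs-distinct xs<∣p∣
  with 0<∣p∣⇒nonempty (p ∖ xs) (+-cancelˡ-< (length xs) 0 _
         (subst₂ _<_ (sym (+-identityʳ (length xs))) (sym (∣∖∣ xs-distinct)) xs<∣p∣))
... | y , y∈p∖xs = y , ∈-∖⁻ xs y∈p∖xs

listed-members : DistinctMembers p xs → length xs ≡ ∣ p ∣ → y ∈ p → y ∈ˡ xs
listed-members {p = p} {xs = xs} {y = y} xs-distinct xs≡p y∈p with any? (y ≟_) xs
... | yes y∈xs = y∈xs
... | no y∉xs = ⊥-elim (n≮0 (subst (∣ p ∖ xs - y ∣ <_) ∣p∖xs∣≡0 (x∈p⇒∣p-x∣<∣p∣ (∈-∖⁺ y∈p (¬Any⇒All¬ xs y∉xs)))))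
  where
  ∣p∖xs∣≡0 : ∣ p ∖ xs ∣ ≡ 0
  ∣p∖xs∣≡0 = +-cancelˡ-≡ (length xs) _ 0
    (trans (∣∖∣ xs-distinct) (trans (sym xs≡p) (sym (+-identityʳ _))))

distinct-members : ∀ m → m ≤ ∣ p ∣ → ∃ λ (xs : Vec (Fin n) m) → DistinctMembers p (toList xs)
distinct-members zero _ = [] , [] , []
distinct-members (suc m) m<∣p∣ with distinct-members m (<⇒≤ m<∣p∣)
... | xs , xs⊆p , xs-distinct with fresh-member (xs⊆p , xs-distinct) (subst (_< _) (sym (length-toList xs)) m<∣p∣)
...   | y , y∈p , y∉xs = y ∷ xs , y∈p ∷ xs⊆p , y∉xs ∷ xs-distinct

∈-quadruple-cases : ∀ {A B : Set} {k w x y z : A} → k ∈ˡ (w ∷ x ∷ y ∷ z ∷ []) →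
                    (k ≡ w → B) → (k ≡ x → B) → (k ≡ y → B) → (k ≡ z → B) → B
∈-quadruple-cases (here k≡w) if-w _ _ _ = if-w k≡w
∈-quadruple-cases (there (here k≡x)) _ if-x _ _ = if-x k≡x
∈-quadruple-cases (there (there (here k≡y))) _ _ if-y _ = if-y k≡y
∈-quadruple-cases (there (there (there (here k≡z)))) _ _ _ if-z = if-z k≡z

module Steiner {n k} {S : Fin n → Set} {T : Blocks n} (steiner : IsSteiner k S T) where

  block-size : ∀ {B} → T B ≡ true → ∣ B ∣ ≡ k
  block-size {B} TB = proj₂ (proj₁ steiner B TB)

  block-points : ∀ {B} → T B ≡ true → x ∈ B → S x
  block-points {B = B} TB = proj₁ (proj₁ steiner B TB) _

  block-through : S x → S y → x ≢ y → ∃ λ B → T B ≡ true × x ∈ B × y ∈ B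
  block-through Sx Sy x≢y = map₂ proj₁ (proj₂ steiner _ _ Sx Sy x≢y)

  block-unique : ∀ {B B′} → T B ≡ true → T B′ ≡ true →
                 x ∈ B → y ∈ B → x ∈ B′ → y ∈ B′ → x ≢ y → B ≡ B′
  block-unique {x} {y} TB TB′ x∈B y∈B x∈B′ y∈B′ x≢y
    with proj₂ steiner x y (block-points TB x∈B) (block-points TB y∈B) x≢y
  ... | _ , _ , unique = trans (sym (unique (TB , x∈B , y∈B))) (unique (TB′ , x∈B′ , y∈B′))

module PairLabelling {A : Set} (G : Set) (L : A → A → A → Set)
  (L-swap : ∀ {i j k} → L i j k → L j i k)
  (L-clash : ∀ {i j j′ k} → i ≢ j → i ≢ j′ → j ≢ j′ → L i j k → L i j′ k → ⊥) where

  -- L i j k: the pair {i, j} is labelled k.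
  Labelled : A → A → A → A → Set
  Labelled i j a c = G ⊎ L i j a ⊎ L i j c

  swap-labels : ∀ {i j a c} → Labelled i j a c → Labelled i j c a
  swap-labels (inj₁ g) = inj₁ g
  swap-labels (inj₂ (inj₁ l)) = inj₂ (inj₂ l)
  swap-labels (inj₂ (inj₂ l)) = inj₂ (inj₁ l)

  forced-label : ∀ {i j a c} → i ≢ j → i ≢ a → j ≢ a → Labelled i j a c → L i a c → (L i j a → G) → G
  forced-label _ _ _ (inj₁ g) _ _ = g
  forced-label _ _ _ (inj₂ (inj₁ lija)) _ continue = continue lija
  forced-label i≢j i≢a j≢a (inj₂ (inj₂ lijc)) liac _ = ⊥-elim (L-clash i≢j i≢a j≢a lijc liac)

  labelling-contradiction : ∀ {w x y z} → w ≢ x → w ≢ y → w ≢ z → x ≢ y → x ≢ z → y ≢ z →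
    Labelled w z x y → Labelled w y z x → Labelled x z w y → Labelled x y z w → L w x y → G
  labelling-contradiction w≢x w≢y w≢z x≢y x≢z y≢z lwz lwy lxz lxy lwxy =
    forced-label w≢z w≢x (≢-sym x≢z) lwz lwxy λ lwzx →
    forced-label w≢y w≢z y≢z lwy lwzx λ lwyz →
    forced-label x≢z (≢-sym w≢x) (≢-sym w≢z) lxz (L-swap lwxy) λ lxzw →
    forced-label x≢y x≢z y≢z lxy lxzw λ lxyz →
    ⊥-elim (L-clash (≢-sym w≢y) (≢-sym x≢y) w≢x (L-swap lwyz) (L-swap lxyz))

  labelling-impossible : ∀ {w x y z} → w ≢ x → w ≢ y → w ≢ z → x ≢ y → x ≢ z → y ≢ z →
    Labelled w x y z → Labelled w z x y → Labelled w y z x → Labelled x z w y → Labelled x y z w → G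
  labelling-impossible _ _ _ _ _ _ (inj₁ g) _ _ _ _ = g
  labelling-impossible w≢x w≢y w≢z x≢y x≢z y≢z (inj₂ (inj₁ lwxy)) lwz lwy lxz lxy =
    labelling-contradiction w≢x w≢y w≢z x≢y x≢z y≢z lwz lwy lxz lxy lwxy
  labelling-impossible w≢x w≢y w≢z x≢y x≢z y≢z (inj₂ (inj₂ lwxz)) lwz lwy lxz lxy =
    labelling-contradiction w≢x w≢z w≢y x≢z x≢y (≢-sym y≢z)
      (swap-labels lwy) (swap-labels lwz) (swap-labels lxy) (swap-labels lxz) lwxz

module _ {v : ℕ} where

  qpt-injective : ∀ {i j} → qpt v i ≡ qpt v j → i ≡ j
  qpt-injective = ↑ˡ-injective v _ _ ∘ Fin.suc-injective

  qpt≢q'pt : ∀ {i j} → qpt v i ≢ q'pt v j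
  qpt≢q'pt {i} {j} qi≡q'j with trans (sym (splitAt-↑ˡ v i v))
                                 (trans (cong (splitAt v) (Fin.suc-injective qi≡q'j)) (splitAt-↑ʳ v v j))
  ... | ()

∈-triple⁻ : ∀ (a b c : Fin n) → x ∈ triple a b c → x ∈ˡ (a ∷ b ∷ c ∷ [])
∈-triple⁻ a b c x∈abc with x∈p∪q⁻ ⁅ a ⁆ _ x∈abc
... | inj₁ x∈a = here (x∈⁅y⁆⇒x≡y a x∈a)
... | inj₂ x∈bc with x∈p∪q⁻ ⁅ b ⁆ ⁅ c ⁆ x∈bc
...   | inj₁ x∈b = there (here (x∈⁅y⁆⇒x≡y b x∈b))
...   | inj₂ x∈c = there (there (here (x∈⁅y⁆⇒x≡y c x∈c)))

∈-triple₃ : ∀ (a b c : Fin n) → c ∈ triple a b c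
∈-triple₃ _ _ _ = x∈p∪q⁺ (inj₂ (x∈p∪q⁺ (inj₂ (x∈⁅x⁆ _))))

qpt∈∞-triple⇒≡ : ∀ {v} {i} (j : Fin v) → qpt v i ∈ triple (∞pt v) (qpt v j) (q'pt v j) → i ≡ j
qpt∈∞-triple⇒≡ {v} j qi∈∞qjq'j with ∈-triple⁻ (∞pt v) (qpt v j) (q'pt v j) qi∈∞qjq'j
... | here ()
... | there (here qi≡qj) = qpt-injective qi≡qj
... | there (there (here qi≡q'j)) = ⊥-elim (qpt≢q'pt qi≡q'j)

Unprimed : ∀ {v} → Subset v → Subset (suc (v + v)) → Set
Unprimed {v} b B = ∀ x → x ∈ B → ∃ λ i → i ∈ b × x ≡ qpt v i

module Placement {v} {b : Subset v} {P : Blocks (suc (v + v))} (placement : IsPlacement b P) where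

  open Steiner (proj₁ (proj₁ placement))

  UnprimedBlock : Set
  UnprimedBlock = ∃ λ B → P B ≡ true × Unprimed b B

  MixedBlock : Fin v → Fin v → Fin v → Set
  MixedBlock i j k = ∃ λ B → P B ≡ true × qpt v i ∈ B × qpt v j ∈ B × q'pt v k ∈ B

  private
    ∞-blocks : ∀ B → P B ≡ true → ∞pt v ∈ B → ∃ λ i → i ∈ b × B ≡ triple (∞pt v) (qpt v i) (q'pt v i)
    ∞-blocks = proj₂ placement

    ∞-point : BlockPts b (∞pt v)
    ∞-point = inj₁ refl

    q-point : ∀ {i} → i ∈ b → BlockPts b (qpt v i)
    q-point {i} i∈b = inj₂ (i , i∈b , inj₁ refl)

  ∞-block-unprimed-unique : ∀ {B i j} → P B ≡ true → ∞pt v ∈ B → qpt v i ∈ B → qpt v j ∈ B → i ≡ j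
  ∞-block-unprimed-unique PB ∞∈B qi∈B qj∈B with ∞-blocks _ PB ∞∈B
  ... | m , _ , refl = trans (qpt∈∞-triple⇒≡ m qi∈B) (sym (qpt∈∞-triple⇒≡ m qj∈B))

  conjugates⇒∞ : ∀ {B i} → P B ≡ true → i ∈ b → qpt v i ∈ B → q'pt v i ∈ B → ∞pt v ∈ B
  conjugates⇒∞ {B} {i} PB i∈b qi∈B q'i∈B with block-through ∞-point (q-point i∈b) (λ ())
  ... | B₀ , PB₀ , ∞∈B₀ , qi∈B₀ with ∞-blocks B₀ PB₀ ∞∈B₀
  ...   | m , _ , refl with qpt∈∞-triple⇒≡ m qi∈B₀
  ...     | refl = subst (∞pt v ∈_) B₀≡B ∞∈B₀
    where
    B₀≡B : triple (∞pt v) (qpt v i) (q'pt v i) ≡ B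
    B₀≡B = block-unique PB₀ PB qi∈B₀ (∈-triple₃ (∞pt v) (qpt v i) (q'pt v i)) qi∈B q'i∈B qpt≢q'pt

  mixed-swap : ∀ {i j k} → MixedBlock i j k → MixedBlock j i k
  mixed-swap (B , PB , qi∈B , qj∈B , q'k∈B) = B , PB , qj∈B , qi∈B , q'k∈B

  mixed-clash : ∀ {i j j′ k} → i ≢ j → i ≢ j′ → j ≢ j′ → MixedBlock i j k → MixedBlock i j′ k → ⊥
  mixed-clash i≢j i≢j′ j≢j′ (B , PB , qi∈B , qj∈B , q'k∈B) (B′ , PB′ , qi∈B′ , qj′∈B′ , q'k∈B′)
    with block-unique PB PB′ qi∈B q'k∈B qi∈B′ q'k∈B′ qpt≢q'pt
  ... | refl with listed-members (qi∈B ∷ q'k∈B ∷ qj∈B ∷ []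
                                , (qpt≢q'pt ∷ (i≢j ∘ qpt-injective) ∷ []) ∷ (≢-sym qpt≢q'pt ∷ []) ∷ [] ∷ [])
                                (sym (block-size PB)) qj′∈B′
  ...   | here qj′≡qi = i≢j′ (sym (qpt-injective qj′≡qi))
  ...   | there (here qj′≡q'k) = qpt≢q'pt qj′≡q'k
  ...   | there (there (here qj′≡qj)) = j≢j′ (sym (qpt-injective qj′≡qj))

  unprimed-or-mixed : ∀ {i j} → i ∈ b → j ∈ b → i ≢ j →
    UnprimedBlock ⊎ ∃ λ k → k ∈ b × k ≢ i × k ≢ j × MixedBlock i j k
  unprimed-or-mixed {i} {j} i∈b j∈b i≢j
    with block-through (q-point i∈b) (q-point j∈b) (i≢j ∘ qpt-injective)
  ... | B , PB , qi∈B , qj∈B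
    with fresh-member (qi∈B ∷ qj∈B ∷ [] , ((i≢j ∘ qpt-injective) ∷ []) ∷ [] ∷ [])
                      (subst (2 <_) (sym (block-size PB)) ≤-refl)
  ... | t , t∈B , t≢qi ∷ t≢qj ∷ [] with block-points PB t∈B
  ...   | inj₁ refl = ⊥-elim (i≢j (∞-block-unprimed-unique PB t∈B qi∈B qj∈B))
  ...   | inj₂ (k , k∈b , inj₁ refl) = inj₁ (B , PB , unprimed)
    where
    unprimed : Unprimed b B
    unprimed x x∈B with listed-members (qi∈B ∷ qj∈B ∷ t∈B ∷ []
                                       , ((i≢j ∘ qpt-injective) ∷ ≢-sym t≢qi ∷ []) ∷ (≢-sym t≢qj ∷ []) ∷ [] ∷ [])
                                       (sym (block-size PB)) x∈B
    ... | here x≡qi = i , i∈b , x≡qi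
    ... | there (here x≡qj) = j , j∈b , x≡qj
    ... | there (there (here x≡qk)) = k , k∈b , x≡qk
  ...   | inj₂ (k , k∈b , inj₂ refl) = inj₂ (k , k∈b , k≢i , k≢j , B , PB , qi∈B , qj∈B , t∈B)
    where
    k≢i : k ≢ i
    k≢i refl = i≢j (∞-block-unprimed-unique PB (conjugates⇒∞ PB i∈b qi∈B t∈B) qi∈B qj∈B)
    k≢j : k ≢ j
    k≢j refl = i≢j (∞-block-unprimed-unique PB (conjugates⇒∞ PB j∈b qj∈B t∈B) qi∈B qj∈B)

  open PairLabelling UnprimedBlock MixedBlock mixed-swap mixed-clash

  labelled : ∀ {i j a c} → i ∈ b → j ∈ b → i ≢ j →
             (∀ {k} → k ∈ b → k ≢ i → k ≢ j → k ≡ a ⊎ k ≡ c) → Labelled i j a c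
  labelled i∈b j∈b i≢j other-two with unprimed-or-mixed i∈b j∈b i≢j
  ... | inj₁ unprimed = inj₁ unprimed
  ... | inj₂ (k , k∈b , k≢i , k≢j , mixed) with other-two k∈b k≢i k≢j
  ...   | inj₁ refl = inj₂ (inj₁ mixed)
  ...   | inj₂ refl = inj₂ (inj₂ mixed)

  unprimed-block : ∣ b ∣ ≡ 4 → UnprimedBlock
  unprimed-block ∣b∣≡4 = from-enumeration (distinct-members 4 (≤-reflexive (sym ∣b∣≡4)))
    where
    from-enumeration : (∃ λ (xs : Vec (Fin v) 4) → DistinctMembers b (toList xs)) → UnprimedBlock
    from-enumeration (w ∷ x ∷ y ∷ z ∷ [] , members@(w∈b ∷ x∈b ∷ y∈b ∷ z∈b ∷ [])
                     , distinct@((w≢x ∷ w≢y ∷ w≢z ∷ []) ∷ (x≢y ∷ x≢z ∷ []) ∷ (y≢z ∷ []) ∷ [] ∷ [])) =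
      labelling-impossible w≢x w≢y w≢z x≢y x≢z y≢z
        (labelled w∈b x∈b w≢x λ k∈b k≢w k≢x → cases k∈b (⊥-elim ∘ k≢w) (⊥-elim ∘ k≢x) inj₁ inj₂)
        (labelled w∈b z∈b w≢z λ k∈b k≢w k≢z → cases k∈b (⊥-elim ∘ k≢w) inj₁ inj₂ (⊥-elim ∘ k≢z))
        (labelled w∈b y∈b w≢y λ k∈b k≢w k≢y → cases k∈b (⊥-elim ∘ k≢w) inj₂ (⊥-elim ∘ k≢y) inj₁)
        (labelled x∈b z∈b x≢z λ k∈b k≢x k≢z → cases k∈b inj₁ (⊥-elim ∘ k≢x) inj₂ (⊥-elim ∘ k≢z))
        (labelled x∈b y∈b x≢y λ k∈b k≢x k≢y → cases k∈b inj₂ (⊥-elim ∘ k≢x) (⊥-elim ∘ k≢y) inj₁)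
      where
      cases : ∀ {k} {A : Set} → k ∈ b → (k ≡ w → A) → (k ≡ x → A) → (k ≡ y → A) → (k ≡ z → A) → A
      cases k∈b = ∈-quadruple-cases (listed-members (members , distinct) (sym ∣b∣≡4) k∈b)

unprimed-monochromatic : ∀ {v δ} {b : Subset v} {B} {c : Fin (suc (v + v)) → Fin δ} →
  Unprimed b B → Monochromatic (c ∘ qpt v) b → Monochromatic c B
unprimed-monochromatic unprimed b-mono x y x∈B y∈B with unprimed x x∈B | unprimed y y∈B
... | i , i∈b , refl | j , j∈b , refl = b-mono i j i∈b j∈b

theorem6p1 : (v δ : ℕ) (Q : Blocks v) → IsQS v Q →
    (T : Blocks (suc (v + v))) → IsKQ Q T →
    Colourable δ T → Colourable δ Q
theorem6p1 v δ Q qs T (_ , _ , placed , T-blocks) (c , c-proper) = c ∘ qpt v , Q-proper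
  where
  Q-proper : IsColouring δ Q (c ∘ qpt v)
  Q-proper b Qb b-mono =
    let B , PB , B-unprimed = Placement.unprimed-block (placed b Qb) (proj₂ (proj₁ qs b Qb))
    in c-proper B (proj₂ (T-blocks B) (b , Qb , PB)) (unprimed-monochromatic B-unprimed b-mono)
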